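{- Suppose $w\in S_{\mathbb{Z}}\setminus S_{\mathbb{Z}_+}$ and let $\boldsymbol{w}$ be a reduced word for $w$. Then \[\mathrm{BS}(w)=1-\min(\operatorname{supp}\boldsymbol{w})=1-\min\{i : s_i\le w\}=1-\min\{j:\theta_j(w)=1\}.\]
   Context: $S_{\mathbb{Z}}$: bijections of $\mathbb{Z}$ fixing all but finitely many integers; $S_{\mathbb{Z}_+}$: those fixing every integer $\le 0$. $s_i=(i\ i{+}1)$; a reduced word of $w$ is $(w_1,\dots,w_k)$ with $w=s_{w_1}\cdots s_{w_k}$ and $k$ minimal; $\operatorname{supp}$ of a word is its set of entries. Bruhat order: $u\le w$ if some reduced word of $w$ has a subword that is a reduced word of $u$. $\gamma(w)(i)=w(i-1)+1$, and $\mathrm{BS}(w)$ is the smallest nonnegative integer $k$ with $\gamma^k(w)\in S_{\mathbb{Z}_+}$. $\theta_j(w)=1$ if some $j'>j$ has $w(j')<w(j)$, else $0$. -}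

module Defs where

open import Data.Nat as ℕ using (ℕ; zero; suc)
open import Data.Integer using (ℤ; +_; _+_; _-_; _≤_; _<_; ∣_∣; _≟_)
open import Data.Bool using (if_then_else_)
open import Data.List using (List; []; _∷_; length)
open import Data.List.Membership.Propositional using (_∈_)
open import Data.List.Relation.Binary.Sublist.Propositional using (_⊆_)
open import Data.Product using (Σ; ∃; _×_; _,_)
open import Relation.Nullary using (¬_; does)
open import Relation.Binary.PropositionalEquality using (_≡_)
open import Function using (id)

record Perm : Set where
  field
    fun     : ℤ → ℤ
    inv     : ℤ → ℤ
    fun-inv : ∀ i → fun (inv i) ≡ i
    inv-fun : ∀ i → inv (fun i) ≡ i
    finite  : Σ ℕ λ N → ∀ i → N ℕ.< ∣ i ∣ → fun i ≡ i
open Perm public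

InSZ+ : (ℤ → ℤ) → Set
InSZ+ f = ∀ i → i ≤ + 0 → f i ≡ i

s : ℤ → ℤ → ℤ
s i x = if does (x ≟ i) then i + + 1
        else if does (x ≟ (i + + 1)) then i else x

eval : List ℤ → ℤ → ℤ
eval []       = id
eval (a ∷ ws) = λ x → s a (eval ws x)

Represents : List ℤ → (ℤ → ℤ) → Set
Represents ws f = ∀ x → eval ws x ≡ f x

Reduced : List ℤ → (ℤ → ℤ) → Set
Reduced ws f = Represents ws f × (∀ vs → Represents vs f → length ws ℕ.≤ length vs)

Bruhat : (ℤ → ℤ) → (ℤ → ℤ) → Set
Bruhat u w = Σ (List ℤ) λ ws → Reduced ws w × Σ (List ℤ) λ vs → (vs ⊆ ws) × Reduced vs u

γ : (ℤ → ℤ) → ℤ → ℤ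
γ f i = f (i - + 1) + + 1

γ^ : ℕ → (ℤ → ℤ) → ℤ → ℤ
γ^ zero    f = f
γ^ (suc k) f = γ (γ^ k f)

IsBS : (ℤ → ℤ) → ℕ → Set
IsBS f k = InSZ+ (γ^ k f) × (∀ j → j ℕ.< k → ¬ InSZ+ (γ^ j f))

θ-one : (ℤ → ℤ) → ℤ → Set
θ-one f j = Σ ℤ λ j' → j < j' × f j' < f j

IsMin : (ℤ → Set) → ℤ → Set
IsMin P m = P m × (∀ x → P x → m ≤ x)

{-# OPTIONS --safe #-}
-- Let m be the least letter of the reduced word. All letters are ≥ m, so w fixes every
-- point below m. It also moves m: otherwise, cutting the word at the last occurrence of m
-- leaves a prefix sending m+1 to m and m to a larger point, an inversion which the
-- deletion property removes together with that occurrence, contradicting reducedness.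
-- Hence m is the least point moved by w, which does not depend on the word, and the rest
-- follows from this: γᵏ(w)(i) = w(i-k)+k, so γᵏ(w) ∈ S_ℤ+ iff w fixes every point < 1-k;
-- s_i ≤ w iff i is a letter of some reduced word of w; and θ_j(w) = 1 first at j = m,
-- witnessed by w⁻¹(m).
module Submission where

open import Defs
open import Data.Nat using (ℕ)
open import Data.Integer using (ℤ; +_; _-_)
open import Data.List using (List)
open import Data.List.Membership.Propositional using (_∈_)
open import Data.Product using (Σ; _×_)
open import Relation.Nullary using (¬_)

open import Algebra.Bundles using (AbelianGroup)
open import Data.Bool using (if_then_else_)
open import Data.Empty using (⊥-elim)
open import Data.Integer using (_+_; -_; _≤_; _<_; _≟_; +0; +[1+_]; -[1+_]; +<+; +≤+)
open import Data.Integer.Properties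
open import Data.Integer.Tactic.RingSolver using (solve-∀)
open import Data.List using ([]; _∷_; _++_; length)
open import Data.List.Properties using (length-++)
open import Data.List.Membership.Propositional using (_∉_)
open import Data.List.Membership.Propositional.Properties using (∈-++⁺ˡ; ∈-++⁺ʳ)
open import Data.List.Relation.Unary.All as All using (All; []; _∷_)
open import Data.List.Relation.Unary.Any using (here; there; any?)
open import Data.List.Relation.Binary.Sublist.Heterogeneous using (fromAny)
open import Data.List.Relation.Binary.Sublist.Propositional.Properties using (Any-resp-⊆)
import Data.List.Extrema ≤-totalOrder as Extrema
import Data.Nat as ℕ
import Data.Nat.Properties as ℕₚ
open import Data.Product using (_,_)
open import Data.Sum using ([_,_]′)
open import Function using (id; _∘_)
open import Function.Definitions using (Injective)
open import Relation.Nullary using (Dec; yes; no; does)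
open import Relation.Binary.Definitions using (DecidableEquality; tri<; tri≈; tri>)
open import Relation.Binary.PropositionalEquality
  using (_≡_; _≢_; refl; sym; trans; cong; subst; subst₂; _≗_; module ≡-Reasoning)
open import Algebra.Properties.Group (AbelianGroup.group +-0-abelianGroup) using (∙-cancelʳ)

i<i+1 : ∀ i → i < i + + 1
i<i+1 i = subst (_< i + + 1) (+-identityʳ i) (+-monoʳ-< i (+<+ (ℕ.s≤s ℕ.z≤n)))

i≢i+1 : ∀ i → i ≢ i + + 1
i≢i+1 i = <⇒≢ (i<i+1 i)

i<j⇒i+1≤j : ∀ {i j} → i < j → i + + 1 ≤ j
i<j⇒i+1≤j {i} {j} i<j = subst (_≤ j) (+-comm (+ 1) i) (i<j⇒suc[i]≤j i<j)

data SView (a x : ℤ) : Set where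
  at-a   : x ≡ a → s a x ≡ a + + 1 → SView a x
  at-a+1 : x ≡ a + + 1 → s a x ≡ a → SView a x
  away   : x ≢ a → x ≢ a + + 1 → s a x ≡ x → SView a x

s-view : ∀ a x → SView a x
s-view a x = view (x ≟ a) (x ≟ a + + 1) refl
  where
  view : (x≟a : Dec (x ≡ a)) (x≟a+1 : Dec (x ≡ a + + 1)) →
         s a x ≡ (if does x≟a then a + + 1 else if does x≟a+1 then a else x) → SView a x
  view (yes x≡a) _           eq = at-a x≡a eq
  view (no x≢a)  (yes x≡a+1) eq = at-a+1 x≡a+1 eq
  view (no x≢a)  (no x≢a+1)  eq = away x≢a x≢a+1 eq

s[a]≡a+1 : ∀ a → s a a ≡ a + + 1
s[a]≡a+1 a with s-view a a
... | at-a _ sa       = sa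
... | at-a+1 a≡a+1 _  = ⊥-elim (i≢i+1 a a≡a+1)
... | away a≢a _ _    = ⊥-elim (a≢a refl)

s[a+1]≡a : ∀ a → s a (a + + 1) ≡ a
s[a+1]≡a a with s-view a (a + + 1)
... | at-a a+1≡a _      = ⊥-elim (i≢i+1 a (sym a+1≡a))
... | at-a+1 _ sa       = sa
... | away _ a+1≢a+1 _  = ⊥-elim (a+1≢a+1 refl)

s-fixes : ∀ {a x} → x ≢ a → x ≢ a + + 1 → s a x ≡ x
s-fixes {a} {x} x≢a x≢a+1 with s-view a x
... | at-a x≡a _     = ⊥-elim (x≢a x≡a)
... | at-a+1 x≡a+1 _ = ⊥-elim (x≢a+1 x≡a+1)
... | away _ _ sx    = sx

s-fixes-below : ∀ {a x} → x < a → s a x ≡ x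
s-fixes-below {a} x<a = s-fixes (<⇒≢ x<a) (<⇒≢ (<-trans x<a (i<i+1 a)))

s-involutive : ∀ a x → s a (s a x) ≡ x
s-involutive a x with s-view a x
... | at-a refl sa   = trans (cong (s a) sa) (s[a+1]≡a a)
... | at-a+1 refl sa = trans (cong (s a) sa) (s[a]≡a+1 a)
... | away _ _ sx    = trans (cong (s a) sx) sx

s-injective : ∀ a → Injective _≡_ _≡_ (s a)
s-injective a {x} {y} eq = begin
  x               ≡⟨ sym (s-involutive a x) ⟩
  s a (s a x)     ≡⟨ cong (s a) eq ⟩
  s a (s a y)     ≡⟨ s-involutive a y ⟩
  y               ∎
  where open ≡-Reasoning

s-index-injective : ∀ {a b} → (∀ x → s a x ≡ s b x) → a ≡ b
s-index-injective {a} {b} sa≗sb with s-view b a | trans (sym (sa≗sb a)) (s[a]≡a+1 a)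
... | at-a a≡b _     | _   = a≡b
... | at-a+1 refl sb | sba =
  ⊥-elim (<-irrefl (trans (sym sb) sba) (<-trans (i<i+1 b) (i<i+1 (b + + 1))))
... | away _ _ sb    | sba = ⊥-elim (i≢i+1 a (trans (sym sb) sba))

s-inversion⇒pair : ∀ {b p q} → p < q → s b q < s b p → p ≡ b × q ≡ b + + 1
s-inversion⇒pair {b} {p} {q} p<q sq<sp with s-view b p | s-view b q
... | at-a p≡b _       | at-a+1 q≡b+1 _ = p≡b , q≡b+1
... | at-a refl _      | at-a refl _     = ⊥-elim (<-irrefl refl p<q)
... | at-a+1 refl _    | at-a+1 refl _   = ⊥-elim (<-irrefl refl p<q)
... | at-a refl sp     | away _ _ sq     = ⊥-elim (<⇒≱ (subst₂ _<_ sq sp sq<sp) (i<j⇒i+1≤j p<q))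
... | at-a+1 refl _    | at-a refl _     = ⊥-elim (<-asym p<q (i<i+1 b))
... | at-a+1 refl sp   | away _ _ sq     =
  ⊥-elim (<-asym (subst₂ _<_ sq sp sq<sp) (<-trans (i<i+1 b) p<q))
... | away _ _ sp      | at-a refl sq    =
  ⊥-elim (<-asym p<q (<-trans (i<i+1 b) (subst₂ _<_ sq sp sq<sp)))
... | away _ _ sp      | at-a+1 refl sq  = ⊥-elim (<⇒≱ p<q (i<j⇒i+1≤j (subst₂ _<_ sq sp sq<sp)))
... | away _ _ sp      | away _ _ sq     = ⊥-elim (<-asym p<q (subst₂ _<_ sq sp sq<sp))

s-conjugate : ∀ {g : ℤ → ℤ} {a b} → Injective _≡_ _≡_ g → g a ≡ b → g (a + + 1) ≡ b + + 1 →
              ∀ x → g (s a x) ≡ s b (g x)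
s-conjugate {g} {a} {b} g-inj ga≡b ga+1≡b+1 x with s-view a x
... | at-a refl sa = begin
  g (s a a)        ≡⟨ cong g sa ⟩
  g (a + + 1)      ≡⟨ ga+1≡b+1 ⟩
  b + + 1          ≡⟨ sym (s[a]≡a+1 b) ⟩
  s b b            ≡⟨ cong (s b) (sym ga≡b) ⟩
  s b (g a)        ∎
  where open ≡-Reasoning
... | at-a+1 refl sa = begin
  g (s a (a + + 1)) ≡⟨ cong g sa ⟩
  g a               ≡⟨ ga≡b ⟩
  b                 ≡⟨ sym (s[a+1]≡a b) ⟩
  s b (b + + 1)     ≡⟨ cong (s b) (sym ga+1≡b+1) ⟩
  s b (g (a + + 1)) ∎
  where open ≡-Reasoning
... | away x≢a x≢a+1 sx = trans (cong g sx) (sym (s-fixes gx≢b gx≢b+1))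
  where
  gx≢b : g x ≢ b
  gx≢b gx≡b = x≢a (g-inj (trans gx≡b (sym ga≡b)))
  gx≢b+1 : g x ≢ b + + 1
  gx≢b+1 gx≡b+1 = x≢a+1 (g-inj (trans gx≡b+1 (sym ga+1≡b+1)))

eval-++ : ∀ xs ys x → eval (xs ++ ys) x ≡ eval xs (eval ys x)
eval-++ []       ys x = refl
eval-++ (a ∷ xs) ys x = cong (s a) (eval-++ xs ys x)

eval-injective : ∀ ws → Injective _≡_ _≡_ (eval ws)
eval-injective []       eq = eq
eval-injective (a ∷ ws) eq = eval-injective ws (s-injective a eq)

eval-fixes-below : ∀ {x} ws → All (x <_) ws → eval ws x ≡ x
eval-fixes-below []       []           = refl
eval-fixes-below (a ∷ ws) (x<a ∷ x<ws) =
  trans (cong (s a) (eval-fixes-below ws x<ws)) (s-fixes-below x<a)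

fixes-below⇒preserves-≥ : ∀ {f : ℤ → ℤ} {m x} → Injective _≡_ _≡_ f →
                          (∀ {y} → y < m → f y ≡ y) → m ≤ x → m ≤ f x
fixes-below⇒preserves-≥ f-inj fixes m≤x =
  ≮⇒≥ λ fx<m → <⇒≱ (subst (_< _) (f-inj (fixes fx<m)) fx<m) m≤x

deletion : ∀ ws a → eval ws (a + + 1) < eval ws a →
           Σ (List ℤ) λ vs → length vs ℕ.< length ws × eval vs ≗ eval ws ∘ s a
deletion []       a descent = ⊥-elim (<-asym descent (i<i+1 a))
deletion (b ∷ ws) a descent with <-cmp (eval ws a) (eval ws (a + + 1))
... | tri> _ _ descent′ =
  let vs , shorter , same = deletion ws a descent′
  in  b ∷ vs , ℕ.s≤s shorter , cong (s b) ∘ same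
... | tri≈ _ eq _ = ⊥-elim (i≢i+1 a (eval-injective ws eq))
... | tri< ascent _ _ = ws , ℕₚ.n<1+n (length ws) , same
  where
  open ≡-Reasoning
  same : ∀ x → eval ws x ≡ s b (eval ws (s a x))
  same x = let a↦b , a+1↦b+1 = s-inversion⇒pair ascent descent in begin
    eval ws x                ≡⟨ sym (s-involutive b (eval ws x)) ⟩
    s b (s b (eval ws x))    ≡⟨ cong (s b) (sym (s-conjugate (eval-injective ws) a↦b a+1↦b+1 x)) ⟩
    s b (eval ws (s a x))    ∎

last-occurrence : ∀ {ℓ} {A : Set ℓ} → DecidableEquality A → ∀ {x : A} {ws} → x ∈ ws →
                  Σ (List A) λ xs → Σ (List A) λ zs → ws ≡ xs ++ x ∷ zs × x ∉ zs
last-occurrence _≟_ {x} {a ∷ ws} x∈a∷ws with any? (x ≟_) ws | x∈a∷ws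
... | yes x∈ws | _ =
  let xs , zs , ws≡ , x∉zs = last-occurrence _≟_ x∈ws
  in  a ∷ xs , zs , cong (a ∷_) ws≡ , x∉zs
... | no x∉ws | here refl    = [] , ws , refl , x∉ws
... | no x∉ws | there x∈ws   = ⊥-elim (x∉ws x∈ws)

least-letter-fixed⇒shorter : ∀ {ws m} → IsMin (_∈ ws) m → eval ws m ≡ m →
                             Σ (List ℤ) λ vs → length vs ℕ.< length ws × eval vs ≗ eval ws
least-letter-fixed⇒shorter {m = m} (m∈ws , m≤ws) fixed with last-occurrence _≟_ m∈ws
... | xs , zs , refl , m∉zs =
  let vs , shorter , same = deletion xs m descent
  in  vs ++ zs
    , subst₂ ℕ._<_ (sym (length-++ vs)) (sym (length-++ xs)) (ℕₚ.+-mono-<-≤ shorter (ℕₚ.n≤1+n _))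
    , λ x → trans (eval-++ vs zs x) (trans (same (eval zs x)) (sym (eval-++ xs (m ∷ zs) x)))
  where
  open ≡-Reasoning
  zs-fixes-m : eval zs m ≡ m
  zs-fixes-m = eval-fixes-below zs (All.tabulate λ {c} c∈zs →
    ≤∧≢⇒< (m≤ws c (∈-++⁺ʳ xs (there c∈zs))) λ { refl → m∉zs c∈zs })
  xs-fixes-below : ∀ {y} → y < m → eval xs y ≡ y
  xs-fixes-below y<m =
    eval-fixes-below xs (All.tabulate λ c∈xs → <-≤-trans y<m (m≤ws _ (∈-++⁺ˡ c∈xs)))
  m+1↦m : eval xs (m + + 1) ≡ m
  m+1↦m = begin
    eval xs (m + + 1)          ≡⟨ cong (eval xs) (sym (s[a]≡a+1 m)) ⟩
    eval xs (s m m)            ≡⟨ cong (eval xs ∘ s m) (sym zs-fixes-m) ⟩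
    eval xs (s m (eval zs m))  ≡⟨ sym (eval-++ xs (m ∷ zs) m) ⟩
    eval (xs ++ m ∷ zs) m      ≡⟨ fixed ⟩
    m                          ∎
  descent : eval xs (m + + 1) < eval xs m
  descent = subst (_< eval xs m) (sym m+1↦m)
    (≤∧≢⇒< (fixes-below⇒preserves-≥ (eval-injective xs) xs-fixes-below ≤-refl)
           (λ m≡ → i≢i+1 m (eval-injective xs (trans (sym m≡) (sym m+1↦m)))))

record LeastMovedPoint (f : ℤ → ℤ) (m : ℤ) : Set where
  field
    moves       : f m ≢ m
    fixes-below : ∀ {x} → x < m → f x ≡ x
open LeastMovedPoint

least-moved-≤ : ∀ {f m x} → LeastMovedPoint f m → f x ≢ x → m ≤ x
least-moved-≤ least fx≢x = ≮⇒≥ λ x<m → fx≢x (fixes-below least x<m)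

least-moved-nonpositive : ∀ {f m} → LeastMovedPoint f m → ¬ InSZ+ f → m ≤ + 0
least-moved-nonpositive least f∉SZ+ =
  ≮⇒≥ λ 0<m → f∉SZ+ λ i i≤0 → fixes-below least (≤-<-trans i≤0 0<m)

least-letter : ∀ {x ws} → x ∈ ws → Σ ℤ λ m → IsMin (_∈ ws) m
least-letter {ws = a ∷ as} _ =
  Extrema.min a as
  , [ here , there ]′ (Extrema.argmin-sel id a as)
  , λ x → All.lookup (Extrema.min≤⊤ a as ∷ Extrema.min≤xs a as)

reduced⇒least-moved : ∀ {ws f m} → Reduced ws f → IsMin (_∈ ws) m → LeastMovedPoint f m
reduced⇒least-moved {ws} {m = m} (represents , minimal) m-least@(_ , m≤ws) = record
  { moves       = λ fm≡m →
      let vs , shorter , same = least-letter-fixed⇒shorter m-least (trans (represents m) fm≡m)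
      in  ℕₚ.<⇒≱ shorter (minimal vs λ x → trans (same x) (represents x))
  ; fixes-below = λ x<m → trans (sym (represents _))
      (eval-fixes-below ws (All.tabulate λ a∈ws → <-≤-trans x<m (m≤ws _ a∈ws)))
  }

least-moved≤letter : ∀ {ws f m i} → LeastMovedPoint f m → Reduced ws f → i ∈ ws → m ≤ i
least-moved≤letter least red i∈ws =
  let m′ , m′-least@(_ , m′≤ws) = least-letter i∈ws
  in  ≤-trans (least-moved-≤ least (moves (reduced⇒least-moved red m′-least))) (m′≤ws _ i∈ws)

letter⇒bruhat : ∀ {ws f i} → Reduced ws f → i ∈ ws → Bruhat (s i) f
letter⇒bruhat {ws} {i = i} red i∈ws = ws , red , i ∷ [] , fromAny i∈ws , (λ _ → refl) , nonempty
  where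
  nonempty : ∀ vs → Represents vs (s i) → 1 ℕ.≤ length vs
  nonempty []      id≗si = ⊥-elim (i≢i+1 i (trans (id≗si i) (s[a]≡a+1 i)))
  nonempty (_ ∷ _) _     = ℕ.s≤s ℕ.z≤n

bruhat⇒letter : ∀ {f i} → Bruhat (s i) f → Σ (List ℤ) λ ws → Reduced ws f × i ∈ ws
bruhat⇒letter {i = i} (_ , _ , [] , _ , (id≗si , _)) =
  ⊥-elim (i≢i+1 i (trans (id≗si i) (s[a]≡a+1 i)))
bruhat⇒letter {i = i} (_ , _ , _ ∷ _ ∷ _ , _ , (_ , minimal)) with minimal (i ∷ []) (λ _ → refl)
... | ℕ.s≤s ()
bruhat⇒letter (ws , red , c ∷ [] , [c]⊆ws , (sc≗si , _)) with s-index-injective sc≗si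
... | refl = ws , red , Any-resp-⊆ [c]⊆ws (here refl)

least-moved⇒bruhat-min : ∀ {ws f m} → Reduced ws f → IsMin (_∈ ws) m → LeastMovedPoint f m →
                         IsMin (λ i → Bruhat (s i) f) m
least-moved⇒bruhat-min red (m∈ws , _) least =
  letter⇒bruhat red m∈ws ,
  λ i si≤f → let _ , red′ , i∈ws′ = bruhat⇒letter si≤f in least-moved≤letter least red′ i∈ws′

fun-injective : ∀ w → Injective _≡_ _≡_ (fun w)
fun-injective w {x} {y} eq = begin
  x                ≡⟨ sym (inv-fun w x) ⟩
  inv w (fun w x)  ≡⟨ cong (inv w) eq ⟩
  inv w (fun w y)  ≡⟨ inv-fun w y ⟩
  y                ∎
  where open ≡-Reasoning

least-moved⇒θ-min : ∀ w {m} → LeastMovedPoint (fun w) m → IsMin (θ-one (fun w)) m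
least-moved⇒θ-min w {m} least = (j , m<j , subst (_< f m) (sym fj≡m) m<fm) , no-θ-below
  where
  f = fun w
  j = inv w m
  fj≡m : f j ≡ m
  fj≡m = fun-inv w m
  preserves-≥ : ∀ {x} → m ≤ x → m ≤ f x
  preserves-≥ = fixes-below⇒preserves-≥ (fun-injective w) (fixes-below least)
  m<fm : m < f m
  m<fm = ≤∧≢⇒< (preserves-≥ ≤-refl) (moves least ∘ sym)
  m<j : m < j
  m<j = ≤∧≢⇒<
    (≮⇒≥ λ j<m → <-irrefl (trans (sym (fixes-below least j<m)) fj≡m) j<m)
    (λ m≡j → moves least (trans (cong f m≡j) fj≡m))
  no-θ-below : ∀ i → θ-one f i → m ≤ i
  no-θ-below i (i′ , i<i′ , fi′<fi) =
    ≮⇒≥ λ i<m → <-asym (i<fi′ i<m) (subst (f i′ <_) (fixes-below least i<m) fi′<fi)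
    where
    i<fi′ : i < m → i < f i′
    i<fi′ i<m with i′ <? m
    ... | yes i′<m = subst (i <_) (sym (fixes-below least i′<m)) i<i′
    ... | no i′≮m  = <-≤-trans i<m (preserves-≥ (≮⇒≥ i′≮m))

γ^-shift : ∀ k f i → γ^ k f i ≡ f (i - + k) + + k
γ^-shift ℕ.zero    f i = sym (trans (+-identityʳ _) (cong f (+-identityʳ i)))
γ^-shift (ℕ.suc k) f i = begin
  γ^ k f (i - + 1) + + 1            ≡⟨ cong (_+ + 1) (γ^-shift k f (i - + 1)) ⟩
  f (i - + 1 - + k) + + k + + 1     ≡⟨ cong (λ y → f y + + k + + 1) (shift-argument i (+ k)) ⟩
  f (i - + ℕ.suc k) + + k + + 1     ≡⟨ shift-value (f (i - + ℕ.suc k)) (+ k) ⟩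
  f (i - + ℕ.suc k) + + ℕ.suc k     ∎
  where
  open ≡-Reasoning
  shift-argument : ∀ i k → i - + 1 - k ≡ i - (+ 1 + k)
  shift-argument = solve-∀
  shift-value : ∀ y k → y + k + + 1 ≡ y + (+ 1 + k)
  shift-value = solve-∀

least-moved⇒IsBS : ∀ {f} k → LeastMovedPoint f (+ 1 - + k) → IsBS f k
least-moved⇒IsBS {f} k least = γ^k-fixes , γ^j-moves
  where
  open ≡-Reasoning
  γ^k-fixes : InSZ+ (γ^ k f)
  γ^k-fixes i i≤0 = begin
    γ^ k f i            ≡⟨ γ^-shift k f i ⟩
    f (i - + k) + + k   ≡⟨ cong (_+ + k) (fixes-below least i-k<1-k) ⟩
    i - + k + + k       ≡⟨ minus-plus i (+ k) ⟩
    i                   ∎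
    where
    i-k<1-k : i - + k < + 1 - + k
    i-k<1-k = +-monoˡ-< (- + k) (≤-<-trans i≤0 (+<+ (ℕ.s≤s ℕ.z≤n)))
    minus-plus : ∀ i k → i - k + k ≡ i
    minus-plus = solve-∀
  γ^j-moves : ∀ j → j ℕ.< k → ¬ InSZ+ (γ^ j f)
  γ^j-moves j j<k γ^j-fixes = moves least (∙-cancelʳ (+ j) _ _ (begin
    f (+ 1 - + k) + + j              ≡⟨ cong (λ y → f y + + j) (sym (plus-minus _ (+ j))) ⟩
    f (+ 1 - + k + + j - + j) + + j  ≡⟨ sym (γ^-shift j f (+ 1 - + k + + j)) ⟩
    γ^ j f (+ 1 - + k + + j)         ≡⟨ γ^j-fixes _ 1-k+j≤0 ⟩
    + 1 - + k + + j                  ∎))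
    where
    plus-minus : ∀ i k → i + k - k ≡ i
    plus-minus = solve-∀
    reorder : ∀ j k → + 1 + j - k ≡ + 1 - k + j
    reorder = solve-∀
    1-k+j≤0 : + 1 - + k + + j ≤ + 0
    1-k+j≤0 = subst (_≤ + 0) (reorder (+ j) (+ k)) (i≤j⇒i-j≤0 (+≤+ j<k))

nonpositive⇒1-k : ∀ {m} → m ≤ + 0 → Σ ℕ λ k → + 1 - + k ≡ m
nonpositive⇒1-k {+0}       _ = 1 , refl
nonpositive⇒1-k { -[1+ n ]} _ = ℕ.suc (ℕ.suc n) , refl
nonpositive⇒1-k {+[1+ n ]} (+≤+ ())

proposition2p4 : (w : Perm) → ¬ InSZ+ (fun w) → (ws : List ℤ) → Reduced ws (fun w) →
    Σ ℕ λ k → IsBS (fun w) k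
      × IsMin (λ i → i ∈ ws) (+ 1 - + k)
      × IsMin (λ i → Bruhat (s i) (fun w)) (+ 1 - + k)
      × IsMin (λ j → θ-one (fun w) j) (+ 1 - + k)
proposition2p4 w w∉SZ+ [] (represents , _) = ⊥-elim (w∉SZ+ λ i _ → sym (represents i))
proposition2p4 w w∉SZ+ ws@(_ ∷ _) red
  with m , m-least ← least-letter {ws = ws} (here refl)
  with least ← reduced⇒least-moved red m-least
  with k , refl ← nonpositive⇒1-k (least-moved-nonpositive least w∉SZ+)
  = k , least-moved⇒IsBS k least , m-least , least-moved⇒bruhat-min red m-least least
  , least-moved⇒θ-min w least
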